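{- Let $\widehat{G}$ be a signed complete bigraph with bipartition $(X,Y)$. If $\widehat{G}$ has a signed simplicial edge, then $\widehat{G}$ is a chordal signed bigraph.
   Context: A signed graph is a finite simple graph in which every edge is assigned a sign, positive or negative. A signed bigraph is a signed graph whose underlying graph is bipartite, with a fixed bipartition $(X,Y)$; it is a signed complete bigraph if the underlying graph is complete bipartite. For a subgraph $H$, $H$ is a biclique if every vertex of $V(H)\cap X$ is adjacent to every vertex of $V(H)\cap Y$, and $H$ is positive if all its edges are positive. For an edge $uv$, let $N(uv)=(N(u)\cup N(v))\setminus\{u,v\}$. The edge $uv$ is signed simplicial if the subgraph induced by $N(uv)$ is a positive biclique. A signed bigraph is a chordal signed bigraph if its edges can be ordered $e_1,\dots,e_m$ so that each $e_i$ is signed simplicial in the signed bigraph obtained by deleting the edges $e_1,\dots,e_{i-1}$ (keeping all vertices). -}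

module Defs where

open import Data.Nat using (ℕ)
open import Data.Fin using (Fin; _≟_)
open import Data.Sum using (_⊎_; inj₁; inj₂)
open import Data.Product using (Σ; ∃; _×_; _,_)
open import Data.Maybe using (Maybe; just; nothing)
open import Data.Unit using (⊤)
open import Data.Empty using (⊥)
open import Data.List using (List; []; _∷_)
open import Data.List.Membership.Propositional using (_∈_)
open import Data.List.Relation.Unary.Unique.Propositional using (Unique)
open import Relation.Binary.PropositionalEquality using (_≡_; _≢_)
open import Relation.Nullary using (yes; no)
open import Function.Bundles using (_⇔_)

data Sign : Set where
  pos neg : Sign

-- A signed bigraph with fixed bipartition (X , Y) = (Fin m , Fin n):
-- G x y = nothing  : no edge between x and y,
-- G x y = just s   : an edge xy with sign s.
-- (Simple graph; all edges go between X and Y.)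
SignedBigraph : ℕ → ℕ → Set
SignedBigraph m n = Fin m → Fin n → Maybe Sign

Vertex : ℕ → ℕ → Set
Vertex m n = Fin m ⊎ Fin n

module _ {m n : ℕ} where

  IsEdge : SignedBigraph m n → Fin m → Fin n → Set
  IsEdge G x y = ∃ λ s → G x y ≡ just s

  Adj : SignedBigraph m n → Vertex m n → Vertex m n → Set
  Adj G (inj₁ x) (inj₂ y) = IsEdge G x y
  Adj G (inj₂ y) (inj₁ x) = IsEdge G x y
  Adj G (inj₁ _) (inj₁ _) = ⊥
  Adj G (inj₂ _) (inj₂ _) = ⊥

  IsComplete : SignedBigraph m n → Set
  IsComplete G = ∀ x y → IsEdge G x y

  InNbhdEdge : SignedBigraph m n → Fin m → Fin n → Vertex m n → Set
  InNbhdEdge G x y w =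
    (Adj G (inj₁ x) w ⊎ Adj G (inj₂ y) w) × w ≢ inj₁ x × w ≢ inj₂ y

  IsBicliqueInduced : SignedBigraph m n → (Vertex m n → Set) → Set
  IsBicliqueInduced G P = ∀ x y → P (inj₁ x) → P (inj₂ y) → IsEdge G x y

  IsPositiveInduced : SignedBigraph m n → (Vertex m n → Set) → Set
  IsPositiveInduced G P =
    ∀ x y s → P (inj₁ x) → P (inj₂ y) → G x y ≡ just s → s ≡ pos

  SignedSimplicial : SignedBigraph m n → Fin m → Fin n → Set
  SignedSimplicial G x y =
    IsEdge G x y
    × IsBicliqueInduced G (InNbhdEdge G x y)
    × IsPositiveInduced G (InNbhdEdge G x y)

  HasSignedSimplicialEdge : SignedBigraph m n → Set
  HasSignedSimplicialEdge G = Σ (Fin m) λ x → Σ (Fin n) λ y → SignedSimplicial G x y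

  deleteEdge : SignedBigraph m n → Fin m → Fin n → SignedBigraph m n
  deleteEdge G x y x' y' with x ≟ x' | y ≟ y'
  ... | yes _ | yes _ = nothing
  ... | _     | _     = G x' y'

  SimplicialSequence : SignedBigraph m n → List (Fin m × Fin n) → Set
  SimplicialSequence G [] = ⊤
  SimplicialSequence G ((x , y) ∷ es) =
    SignedSimplicial G x y × SimplicialSequence (deleteEdge G x y) es

  IsEdgeOrdering : SignedBigraph m n → List (Fin m × Fin n) → Set
  IsEdgeOrdering G es =
    Unique es × (∀ x y → ((x , y) ∈ es) ⇔ IsEdge G x y)

  IsChordalSignedBigraph : SignedBigraph m n → Set
  IsChordalSignedBigraph G =
    Σ (List (Fin m × Fin n)) λ es → IsEdgeOrdering G es × SimplicialSequence G es

-- Write the simplicial edge as xy. In a complete bigraph N(xy) is everything but x and y, so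
-- every edge missing both x and y is positive. Delete the edges row by row, starting with the
-- row of x and, within each row, with the column of y. When ab is deleted, the X-vertices of
-- N(ab) are in later rows and its Y-vertices are later columns of row a, so every edge between
-- them is still present and misses both x and y: N(ab) is a positive biclique.
module Submission where

open import Defs
open import Data.Nat using (ℕ)
open import Data.Fin using (Fin; _≟_)
open import Data.Sum using (_⊎_; inj₁; inj₂)
open import Data.Sum.Properties using (inj₁-injective; inj₂-injective)
open import Data.Product using (_×_; _,_; proj₁; proj₂)
open import Data.Maybe using (just)
open import Data.Unit using (⊤; tt)
open import Data.Empty using (⊥-elim)
open import Data.List using (List; []; _∷_; map; _++_; filter; allFin; cartesianProduct)
open import Data.List.Membership.Propositional using (_∈_; _∉_)
open import Data.List.Membership.Propositional.Properties
  using (∈-++⁻; ∈-++⁺ʳ; ∈-map⁻; ∈-cartesianProduct⁺; ∈-cartesianProduct⁻; ∈-filter⁺; ∈-filter⁻; ∈-allFin)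
open import Data.List.Relation.Binary.Subset.Propositional using (_⊆_)
open import Data.List.Relation.Unary.Any using (here; there)
open import Data.List.Relation.Unary.All as All using (All; []; _∷_)
open import Data.List.Relation.Unary.All.Properties using (All¬⇒¬Any)
open import Data.List.Relation.Unary.AllPairs using ([]; _∷_)
open import Data.List.Relation.Unary.Unique.Propositional using (Unique)
open import Data.List.Relation.Unary.Unique.Propositional.Properties
  using (cartesianProduct⁺; filter⁺; allFin⁺)
open import Relation.Binary.PropositionalEquality using (_≡_; _≢_; refl; sym; trans; cong)
open import Relation.Nullary using (yes; no; ¬_; ¬?)
open import Function.Base using (id)
open import Function.Bundles using (mk⇔; Equivalence)

allFinExcept : ∀ {k} → Fin k → List (Fin k)
allFinExcept {k} x = filter (λ a → ¬? (a ≟ x)) (allFin k)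

allFinExcept-unique : ∀ {k} (x : Fin k) → Unique (allFinExcept x)
allFinExcept-unique {k} x = filter⁺ (λ a → ¬? (a ≟ x)) (allFin⁺ k)

∈-allFinExcept⁻ : ∀ {k} {x a : Fin k} → a ∈ allFinExcept x → a ≢ x
∈-allFinExcept⁻ {k} {x} p = proj₂ (∈-filter⁻ (λ a → ¬? (a ≟ x)) {xs = allFin k} p)

∈-allFinExcept⁺ : ∀ {k} {x a : Fin k} → a ≢ x → a ∈ allFinExcept x
∈-allFinExcept⁺ {x = x} {a} a≢x = ∈-filter⁺ (λ a → ¬? (a ≟ x)) (∈-allFin a) a≢x

startingAt : ∀ {k} → Fin k → List (Fin k)
startingAt x = x ∷ allFinExcept x

startingAt-unique : ∀ {k} (x : Fin k) → Unique (startingAt x)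
startingAt-unique x =
  All.tabulate (λ p x≡a → ∈-allFinExcept⁻ p (sym x≡a)) ∷ allFinExcept-unique x

∈-startingAt : ∀ {k} (x a : Fin k) → a ∈ startingAt x
∈-startingAt x a with a ≟ x
... | yes refl = here refl
... | no a≢x   = there (∈-allFinExcept⁺ a≢x)

module _ {m n : ℕ} (H : SignedBigraph m n) (a : Fin m) (b : Fin n) where

  deleteEdge-removes : ¬ IsEdge (deleteEdge H a b) a b
  deleteEdge-removes with a ≟ a | b ≟ b
  ... | yes _  | yes _  = λ ()
  ... | yes _  | no b≢b = ⊥-elim (b≢b refl)
  ... | no a≢a | _      = ⊥-elim (a≢a refl)

  deleteEdge-other : ∀ {a' b'} → (a , b) ≢ (a' , b') → deleteEdge H a b a' b' ≡ H a' b'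
  deleteEdge-other {a'} {b'} ab≢a'b' with a ≟ a' | b ≟ b'
  ... | yes refl | yes refl = ⊥-elim (ab≢a'b' refl)
  ... | yes _    | no _     = refl
  ... | no _     | _        = refl

  deleteEdge-⊆ : ∀ {a' b' s} → deleteEdge H a b a' b' ≡ just s → H a' b' ≡ just s
  deleteEdge-⊆ {a'} {b'} with a ≟ a' | b ≟ b'
  ... | yes _ | yes _ = λ ()
  ... | yes _ | no _  = id
  ... | no _  | _     = id

IsEdgeOrdering-deleteEdge : ∀ {m n} {H : SignedBigraph m n} {a b es} →
  IsEdgeOrdering H ((a , b) ∷ es) → IsEdgeOrdering (deleteEdge H a b) es
IsEdgeOrdering-deleteEdge {H = H} {a} {b} {es} (ab∉es ∷ unique , edges) =
  unique , λ a' b' → mk⇔ (to a' b') (from a' b')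
  where
  to : ∀ a' b' → (a' , b') ∈ es → IsEdge (deleteEdge H a b) a' b'
  to a' b' p with Equivalence.to (edges a' b') (there p)
  ... | s , e = s , trans (deleteEdge-other H a b (All.lookup ab∉es p)) e
  from : ∀ a' b' → IsEdge (deleteEdge H a b) a' b' → (a' , b') ∈ es
  from a' b' (s , e) with Equivalence.from (edges a' b') (s , deleteEdge-⊆ H a b e)
  ... | here refl = ⊥-elim (deleteEdge-removes H a b (s , e))
  ... | there p   = p

-- Once the edges before ab are deleted, the a' and b' below range over the X- and Y-vertices of N(ab).
NeighbourhoodClosed : {A B : Set} → (A → B → Set) → List (A × B) → Set
NeighbourhoodClosed Q [] = ⊤
NeighbourhoodClosed Q ((a , b) ∷ es) =
  (∀ {a' b'} → a' ≢ a → (a' , b) ∈ es → (a , b') ∈ es → (a' , b') ∈ es × Q a' b')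
  × NeighbourhoodClosed Q es

PositiveOn : ∀ {m n} → (Fin m → Fin n → Set) → SignedBigraph m n → Set
PositiveOn Q H = ∀ {a b s} → Q a b → H a b ≡ just s → s ≡ pos

module _ {m n : ℕ} {Q : Fin m → Fin n → Set} where

  head-signedSimplicial : ∀ {H : SignedBigraph m n} {a b es} →
    IsEdgeOrdering H ((a , b) ∷ es) → NeighbourhoodClosed Q ((a , b) ∷ es) → PositiveOn Q H →
    SignedSimplicial H a b
  head-signedSimplicial {H} {a} {b} {es} (_ , edges) (closed , _) positive =
    Equivalence.to (edges a b) (here refl) , biclique , positivity
    where
    later-X : ∀ {a'} → InNbhdEdge H a b (inj₁ a') → a' ≢ a × (a' , b) ∈ es
    later-X (inj₁ () , _)
    later-X {a'} (inj₂ e , a'≢a , _) with Equivalence.from (edges a' b) e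
    ... | here refl = ⊥-elim (a'≢a refl)
    ... | there p   = (λ a'≡a → a'≢a (cong inj₁ a'≡a)) , p
    later-Y : ∀ {b'} → InNbhdEdge H a b (inj₂ b') → (a , b') ∈ es
    later-Y (inj₂ () , _)
    later-Y {b'} (inj₁ e , _ , b'≢b) with Equivalence.from (edges a b') e
    ... | here refl = ⊥-elim (b'≢b refl)
    ... | there p   = p
    completed : ∀ {a' b'} → InNbhdEdge H a b (inj₁ a') → InNbhdEdge H a b (inj₂ b') →
      (a' , b') ∈ es × Q a' b'
    completed p q = closed (proj₁ (later-X p)) (proj₂ (later-X p)) (later-Y q)
    biclique : IsBicliqueInduced H (InNbhdEdge H a b)
    biclique a' b' p q = Equivalence.to (edges a' b') (there (proj₁ (completed p q)))
    positivity : IsPositiveInduced H (InNbhdEdge H a b)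
    positivity a' b' s p q = positive (proj₂ (completed p q))

  simplicialSequence : ∀ {H : SignedBigraph m n} es → IsEdgeOrdering H es →
    NeighbourhoodClosed Q es → PositiveOn Q H → SimplicialSequence H es
  simplicialSequence [] _ _ _ = tt
  simplicialSequence {H} ((a , b) ∷ es) ordering closed@(_ , closedTail) positive =
    head-signedSimplicial ordering closed positive ,
    simplicialSequence es (IsEdgeOrdering-deleteEdge ordering) closedTail
      (λ q e → positive q (deleteEdge-⊆ H a b e))

module RowMajor {A B : Set} {P : A → Set} {R : B → Set} (c : B) (cs : List B) (Rcs : All R cs) where

  Q : A → B → Set
  Q a b = P a × R b

  ∈-rowThenProduct⁻ : ∀ {r : A} rs ds {a b} → (a , b) ∈ map (r ,_) ds ++ cartesianProduct rs (c ∷ cs) →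
    (a ≡ r × b ∈ ds) ⊎ (a ∈ rs × b ∈ c ∷ cs)
  ∈-rowThenProduct⁻ {r} rs ds p with ∈-++⁻ (map (r ,_) ds) p
  ... | inj₁ q with ∈-map⁻ (r ,_) q
  ...   | _ , d∈ds , refl = inj₁ (refl , d∈ds)
  ∈-rowThenProduct⁻ rs ds p | inj₂ q = inj₂ (∈-cartesianProduct⁻ rs (c ∷ cs) q)

  closed-row : ∀ {r : A} {rs : List A} d ds → r ∉ rs → All P rs → ds ⊆ cs →
    NeighbourhoodClosed Q (cartesianProduct rs (c ∷ cs)) →
    NeighbourhoodClosed Q (map (r ,_) (d ∷ ds) ++ cartesianProduct rs (c ∷ cs))
  closed-row {r} {rs} d ds r∉rs Prs ds⊆cs closedRest = head-closed , rest-closed ds ds⊆cs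
    where
    head-closed : ∀ {a' b'} → a' ≢ r → (a' , d) ∈ map (r ,_) ds ++ cartesianProduct rs (c ∷ cs) →
      (r , b') ∈ map (r ,_) ds ++ cartesianProduct rs (c ∷ cs) →
      (a' , b') ∈ map (r ,_) ds ++ cartesianProduct rs (c ∷ cs) × Q a' b'
    head-closed a'≢r p q with ∈-rowThenProduct⁻ rs ds p | ∈-rowThenProduct⁻ rs ds q
    ... | inj₁ (a'≡r , _)  | _                = ⊥-elim (a'≢r a'≡r)
    ... | inj₂ _           | inj₂ (r∈rs , _)  = ⊥-elim (r∉rs r∈rs)
    ... | inj₂ (a'∈rs , _) | inj₁ (_ , b'∈ds) =
      ∈-++⁺ʳ (map (r ,_) ds) (∈-cartesianProduct⁺ a'∈rs (there (ds⊆cs b'∈ds))) ,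
      All.lookup Prs a'∈rs , All.lookup Rcs (ds⊆cs b'∈ds)
    rest-closed : ∀ ds → ds ⊆ cs → NeighbourhoodClosed Q (map (r ,_) ds ++ cartesianProduct rs (c ∷ cs))
    rest-closed []        _       = closedRest
    rest-closed (d' ∷ ds) d'ds⊆cs = closed-row d' ds r∉rs Prs (λ p → d'ds⊆cs (there p)) closedRest

  rowMajor-closed : ∀ {r : A} {rs : List A} → Unique (r ∷ rs) → All P rs →
    NeighbourhoodClosed Q (cartesianProduct (r ∷ rs) (c ∷ cs))
  closed-product : ∀ {rs : List A} → Unique rs → All P rs →
    NeighbourhoodClosed Q (cartesianProduct rs (c ∷ cs))

  rowMajor-closed (r∉rs ∷ unique) Prs =
    closed-row c cs (All¬⇒¬Any r∉rs) Prs id (closed-product unique Prs)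

  closed-product []             []        = tt
  closed-product unique@(_ ∷ _) (_ ∷ Prs) = rowMajor-closed unique Prs

complete-simplicial-positive : ∀ {m n} {G : SignedBigraph m n} {x y} → IsComplete G →
  SignedSimplicial G x y → PositiveOn (λ a b → a ≢ x × b ≢ y) G
complete-simplicial-positive {x = x} {y} complete (_ , _ , positive) {a} {b} (a≢x , b≢y) =
  positive a b _
    (inj₂ (complete a y) , (λ eq → a≢x (inj₁-injective eq)) , λ ())
    (inj₁ (complete x b) , (λ ()) , λ eq → b≢y (inj₂-injective eq))

lemma2p1 : (m n : ℕ) (G : SignedBigraph m n) →
    IsComplete G → HasSignedSimplicialEdge G → IsChordalSignedBigraph G
lemma2p1 m n G complete (x , y , simplicial) =
  es , ordering , simplicialSequence es ordering closed (complete-simplicial-positive complete simplicial)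
  where
  open RowMajor y (allFinExcept y) (All.tabulate ∈-allFinExcept⁻)
  es = cartesianProduct (startingAt x) (startingAt y)
  ordering : IsEdgeOrdering G es
  ordering =
    cartesianProduct⁺ (startingAt-unique x) (startingAt-unique y) ,
    λ a b → mk⇔ (λ _ → complete a b)
                (λ _ → ∈-cartesianProduct⁺ (∈-startingAt x a) (∈-startingAt y b))
  closed : NeighbourhoodClosed (λ a b → a ≢ x × b ≢ y) es
  closed = rowMajor-closed (startingAt-unique x) (All.tabulate ∈-allFinExcept⁻)
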